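{- Let $\Delta$ be a finite saturated sample set and $\delta$ a $\Delta$-diagram. For every basic term $t$ and every homomorphism $h$ from the term algebra to $\mathbf{W}$, if $h(x)$ strongly extends $\mathrm{diag}_x(\delta)$ for each variable $x$ occurring in $t$, then $h(t)$ strongly extends $\mathrm{diag}_t(\delta)$.
   Context: Let $\omega^+=\omega\cup\{\omega\}$ with its natural order; $S(n)=n+1$ for $n\in\omega$, $S(\omega)=\omega$. A time warp is a join-preserving map $\omega^+\to\omega^+$ (equivalently, order-preserving with $f(0)=0$ and $f(\omega)=\sup_{n\in\omega}f(n)$); $\mathrm{last}(f)=\min\{m\in\omega^+\mid f(m)=f(\omega)\}$. With $p$ the predecessor time warp ($p(0)=0$, $p(\omega)=\omega$, $p(m)=m-1$ otherwise), $\mathbf{W}=\langle W,\wedge,\vee,\circ,{}',\mathrm{id}\rangle$ is the algebra of time warps with pointwise $\wedge,\vee$, composition, identity and $f'$ the largest time warp $g$ with $f\circ g\le p$. Terms use variables and $\wedge,\vee,\cdot,{}',1$; basic terms use only variables, $\cdot$, ${}'$, $1$. Samples: fix a countably infinite set of time variables $\kappa$. Samples are generated by $\alpha::=\kappa\mid t[\alpha]\mid\mathrm{suc}(\alpha)\mid\mathrm{last}(t)$ with $t$ basic (purely syntactic). Let $\leadsto$ be given, for basic $t,u$ and samples $\alpha$, by: $t[\alpha]\leadsto\alpha$; $(t\cdot u)[\alpha]\leadsto t[u[\alpha]]$; $\mathrm{suc}(\alpha)\leadsto\alpha$; $t'[\alpha]\leadsto t[t'[\alpha]]$; $t[\alpha]\leadsto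 t[\mathrm{last}(t)]$; $t'[\alpha]\leadsto t[\mathrm{suc}(t'[\alpha])]$. $\Delta$ is saturated if $\alpha\in\Delta$, $\alpha\leadsto\beta$ imply $\beta\in\Delta$. A $\Delta$-diagram is a map $\delta\colon\Delta\to\omega^+$ such that: (1) $t[\alpha],t[\beta]\in\Delta$, $\delta(\alpha)\le\delta(\beta)$ imply $\delta(t[\alpha])\le\delta(t[\beta])$; (2) $t[\alpha]\in\Delta$, $\delta(\alpha)=0$ imply $\delta(t[\alpha])=0$; (3) $\mathrm{suc}(\alpha)\in\Delta$ implies $\delta(\mathrm{suc}(\alpha))=S(\delta(\alpha))$; (4) for $t[\alpha]\in\Delta$: $\delta(\mathrm{last}(t))\le\delta(\alpha)$ iff $\delta(t[\mathrm{last}(t)])=\delta(t[\alpha])$; (5) $t[\mathrm{last}(t)]\in\Delta$, $\delta(\mathrm{last}(t))=\omega$ imply $\delta(t[\mathrm{last}(t)])=\omega$; (6) $1[\alpha]\in\Delta$ implies $\delta(1[\alpha])=\delta(\alpha)$; (7) $\mathrm{last}(1)\in\Delta$ implies $\delta(\mathrm{last}(1))=\omega$; (8) $(t\cdot u)[\alpha]\in\Delta$ implies $\delta((t\cdot u)[\alpha])=\delta(t[u[\alpha]])$; (9) $\mathrm{last}(t\cdot u),\mathrm{last}(t),\mathrm{last}(u)\in\Delta$, $\delta(\mathrm{last}(t\cdot u))=\omega$ imply $\delta(\mathrm{last}(t))=\delta(\mathrm{last}(u))=\omega$; (10) $t'[\alpha]\in\Delta$, $0<\delta(\alpha)<\omega$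 imply $\delta(t[t'[\alpha]])<\delta(\alpha)$; (11) $t'[\alpha]\in\Delta$, $\delta(t'[\alpha])<\omega$ imply $\delta(\alpha)\le\delta(t[\mathrm{suc}(t'[\alpha])])$; (12) $\mathrm{last}(t'),\mathrm{last}(t)\in\Delta$, $\delta(\mathrm{last}(t'))=\omega$ imply $\delta(\mathrm{last}(t))=\omega$. For a basic term $t$, $\mathrm{diag}_t(\delta)=\{(\delta(\alpha),\delta(t[\alpha]))\mid t[\alpha]\in\Delta\}$. A time warp $f$ extends $\mathrm{diag}_t(\delta)$ if $f(i)=j$ for all $(i,j)\in\mathrm{diag}_t(\delta)$; it strongly extends $\mathrm{diag}_t(\delta)$ if it extends it and, whenever $\mathrm{diag}_t(\delta)\neq\emptyset$ and $\delta(\mathrm{last}(t))=\omega$, also $\mathrm{last}(f)=\omega$. -}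

module Defs where

open import Data.Nat using (ℕ; zero; suc; _∸_; _⊓_; _⊔_) renaming (_≤_ to _≤ℕ_)
open import Data.Product using (Σ; ∃; _×_; _,_)
open import Data.List using (List)
open import Data.List.Membership.Propositional using (_∈_)
open import Relation.Binary.PropositionalEquality using (_≡_)
open import Relation.Nullary using (¬_)
open import Function.Bundles using (_⇔_)

data ω⁺ : Set where
  fin : ℕ → ω⁺
  ω   : ω⁺

infix 4 _≤ω_ _<ω_
data _≤ω_ : ω⁺ → ω⁺ → Set where
  fin≤fin : ∀ {m n} → m ≤ℕ n → fin m ≤ω fin n
  ≤ω-top  : ∀ x → x ≤ω ω

_<ω_ : ω⁺ → ω⁺ → Set
x <ω y = x ≤ω y × ¬ (x ≡ y)

S : ω⁺ → ω⁺
S (fin n) = fin (suc n)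
S ω       = ω

minω : ω⁺ → ω⁺ → ω⁺
minω (fin m) (fin n) = fin (m ⊓ n)
minω (fin m) ω       = fin m
minω ω       y       = y

maxω : ω⁺ → ω⁺ → ω⁺
maxω (fin m) (fin n) = fin (m ⊔ n)
maxω (fin m) ω       = ω
maxω ω       y       = ω

-- Time warps: join-preserving maps ω⁺ → ω⁺, i.e. order-preserving,
-- f 0 = 0, and f ω = sup_{n ∈ ω} f n (least upper bound).

record TimeWarp : Set where
  field
    fn     : ω⁺ → ω⁺
    mono   : ∀ {x y} → x ≤ω y → fn x ≤ω fn y
    strict : fn (fin 0) ≡ fin 0
    supUB  : ∀ n → fn (fin n) ≤ω fn ω
    supLUB : ∀ u → (∀ n → fn (fin n) ≤ω u) → fn ω ≤ω u
open TimeWarp public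

p : ω⁺ → ω⁺
p (fin n) = fin (n ∸ 1)
p ω       = ω

IsLast : TimeWarp → ω⁺ → Set
IsLast f m = fn f m ≡ fn f ω × (∀ k → fn f k ≡ fn f ω → m ≤ω k)

IsResidual : TimeWarp → TimeWarp → Set
IsResidual f g =
  (∀ x → fn f (fn g x) ≤ω p x) ×
  (∀ (g₁ : TimeWarp) → (∀ x → fn f (fn g₁ x) ≤ω p x) → ∀ x → fn g₁ x ≤ω fn g x)

infixl 7 _·ₜ_ _·_
infixl 6 _∧ₜ_
infixl 5 _∨ₜ_

data Term : Set where
  var  : ℕ → Term
  _∧ₜ_ : Term → Term → Term
  _∨ₜ_ : Term → Term → Term
  _·ₜ_ : Term → Term → Term
  _′ₜ  : Term → Term
  𝟏ₜ   : Term

data BTerm : Set where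
  bvar : ℕ → BTerm
  _·_  : BTerm → BTerm → BTerm
  _′   : BTerm → BTerm
  𝟏    : BTerm

⌜_⌝ : BTerm → Term
⌜ bvar x ⌝ = var x
⌜ t · u ⌝  = ⌜ t ⌝ ·ₜ ⌜ u ⌝
⌜ t ′ ⌝    = ⌜ t ⌝ ′ₜ
⌜ 𝟏 ⌝      = 𝟏ₜ

data Occurs (x : ℕ) : BTerm → Set where
  here  : Occurs x (bvar x)
  ·ˡ    : ∀ {t u} → Occurs x t → Occurs x (t · u)
  ·ʳ    : ∀ {t u} → Occurs x u → Occurs x (t · u)
  ′-in  : ∀ {t} → Occurs x t → Occurs x (t ′)

record Hom : Set where
  field
    h    : Term → TimeWarp
    h-∧  : ∀ t u x → fn (h (t ∧ₜ u)) x ≡ minω (fn (h t) x) (fn (h u) x)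
    h-∨  : ∀ t u x → fn (h (t ∨ₜ u)) x ≡ maxω (fn (h t) x) (fn (h u) x)
    h-·  : ∀ t u x → fn (h (t ·ₜ u)) x ≡ fn (h t) (fn (h u) x)
    h-′  : ∀ t → IsResidual (h t) (h (t ′ₜ))
    h-𝟏  : ∀ x → fn (h 𝟏ₜ) x ≡ x
open Hom public

data Sample : Set where
  tv    : ℕ → Sample
  _[_]  : BTerm → Sample → Sample
  sucₛ  : Sample → Sample
  lastₛ : BTerm → Sample

infix 4 _⇝_
data _⇝_ : Sample → Sample → Set where
  r1 : ∀ t α → t [ α ] ⇝ α
  r2 : ∀ t u α → (t · u) [ α ] ⇝ t [ u [ α ] ]
  r3 : ∀ α → sucₛ α ⇝ α
  r4 : ∀ t α → (t ′) [ α ] ⇝ t [ (t ′) [ α ] ]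
  r5 : ∀ t α → t [ α ] ⇝ t [ lastₛ t ]
  r6 : ∀ t α → (t ′) [ α ] ⇝ t [ sucₛ ((t ′) [ α ]) ]

SampleSet : Set
SampleSet = List Sample

Saturated : SampleSet → Set
Saturated Δ = ∀ {α β} → α ∈ Δ → α ⇝ β → β ∈ Δ

-- A Δ-diagram. δ is given as a function on all samples; only its values
-- on Δ are constrained (and used).
record IsDiagram (Δ : SampleSet) (δ : Sample → ω⁺) : Set where
  field
    d1  : ∀ t α β → t [ α ] ∈ Δ → t [ β ] ∈ Δ → δ α ≤ω δ β →
          δ (t [ α ]) ≤ω δ (t [ β ])
    d2  : ∀ t α → t [ α ] ∈ Δ → δ α ≡ fin 0 → δ (t [ α ]) ≡ fin 0
    d3  : ∀ α → sucₛ α ∈ Δ → δ (sucₛ α) ≡ S (δ α)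
    d4  : ∀ t α → t [ α ] ∈ Δ →
          (δ (lastₛ t) ≤ω δ α) ⇔ (δ (t [ lastₛ t ]) ≡ δ (t [ α ]))
    d5  : ∀ t → t [ lastₛ t ] ∈ Δ → δ (lastₛ t) ≡ ω → δ (t [ lastₛ t ]) ≡ ω
    d6  : ∀ α → 𝟏 [ α ] ∈ Δ → δ (𝟏 [ α ]) ≡ δ α
    d7  : lastₛ 𝟏 ∈ Δ → δ (lastₛ 𝟏) ≡ ω
    d8  : ∀ t u α → (t · u) [ α ] ∈ Δ → δ ((t · u) [ α ]) ≡ δ (t [ u [ α ] ])
    d9  : ∀ t u → lastₛ (t · u) ∈ Δ → lastₛ t ∈ Δ → lastₛ u ∈ Δ →
          δ (lastₛ (t · u)) ≡ ω → δ (lastₛ t) ≡ ω × δ (lastₛ u) ≡ ω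
    d10 : ∀ t α → (t ′) [ α ] ∈ Δ → fin 0 <ω δ α → δ α <ω ω →
          δ (t [ (t ′) [ α ] ]) <ω δ α
    d11 : ∀ t α → (t ′) [ α ] ∈ Δ → δ ((t ′) [ α ]) <ω ω →
          δ α ≤ω δ (t [ sucₛ ((t ′) [ α ]) ])
    d12 : ∀ t → lastₛ (t ′) ∈ Δ → lastₛ t ∈ Δ → δ (lastₛ (t ′)) ≡ ω →
          δ (lastₛ t) ≡ ω

-- f extends diag_t(δ) = {(δ α, δ(t[α])) | t[α] ∈ Δ}
Extends : SampleSet → (Sample → ω⁺) → BTerm → TimeWarp → Set
Extends Δ δ t f = ∀ α → t [ α ] ∈ Δ → fn f (δ α) ≡ δ (t [ α ])

DiagNonEmpty : SampleSet → BTerm → Set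
DiagNonEmpty Δ t = ∃ λ α → t [ α ] ∈ Δ

StronglyExtends : SampleSet → (Sample → ω⁺) → BTerm → TimeWarp → Set
StronglyExtends Δ δ t f =
  Extends Δ δ t f ×
  (DiagNonEmpty Δ t → δ (lastₛ t) ≡ ω → IsLast f ω)

-- Products compose the two strong extensions, and the last
-- point ω of h(t · u) comes from those of h(t) and h(u) via axiom (9). For a
-- residual g = h(t)′ of f = h(t) the key fact is the Galois connection
--   f y ≤ n  ⇒  y ≤ g (n + 1)       and       x ≤ f (m + 1)  ⇒  g x ≤ m,
-- the first witnessed by a step warp below g, the second by f ∘ g ≤ p.
-- Axioms (10) and (11) say that δ(t′[α]) satisfies exactly these bounds
-- relative to δ(α), which pins g (δ α) down to δ(t′[α]). When δ(α) = ω the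
-- lower bound needs f to stay finite below δ(t′[α]): either last(t′) = ω and
-- last(h(t)) = ω by (12), or δ(t′[α]) = δ(t′[last(t′)]), which (10) keeps
-- finite under f.
module Submission where

open import Defs
open import Data.Nat using (ℕ; zero; suc; _∸_; _≤_; z≤n; s≤s; _≤?_)
open import Data.Nat.Properties using (≤-refl; ≤-trans; ≤-antisym; ≰⇒>; n≮n)
open import Data.Product using (_×_; _,_; proj₁; proj₂)
open import Data.Sum using (_⊎_; inj₁; inj₂)
open import Data.Empty using (⊥-elim)
open import Data.List.Membership.Propositional using (_∈_)
open import Function using (_∘_)
open import Function.Bundles using (Equivalence)
open import Relation.Nullary using (¬_; yes; no)
open import Relation.Binary.Bundles using (Preorder)
open import Relation.Binary.PropositionalEquality
  using (_≡_; _≢_; refl; sym; trans; cong; subst; isEquivalence)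
import Relation.Binary.Reasoning.Preorder as PreorderReasoning

≤ω-refl : ∀ {x} → x ≤ω x
≤ω-refl {fin n} = fin≤fin ≤-refl
≤ω-refl {ω}     = ≤ω-top ω

≤ω-reflexive : ∀ {x y} → x ≡ y → x ≤ω y
≤ω-reflexive refl = ≤ω-refl

≤ω-trans : ∀ {x y z} → x ≤ω y → y ≤ω z → x ≤ω z
≤ω-trans (fin≤fin m≤n) (fin≤fin n≤k) = fin≤fin (≤-trans m≤n n≤k)
≤ω-trans _             (≤ω-top _)    = ≤ω-top _

≤ω-antisym : ∀ {x y} → x ≤ω y → y ≤ω x → x ≡ y
≤ω-antisym (fin≤fin m≤n) (fin≤fin n≤m) = cong fin (≤-antisym m≤n n≤m)
≤ω-antisym (≤ω-top ω)    _             = refl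

≤ω-preorder : Preorder _ _ _
≤ω-preorder = record
  { isPreorder = record
    { isEquivalence = isEquivalence
    ; reflexive     = ≤ω-reflexive
    ; trans         = ≤ω-trans
    }
  }

open PreorderReasoning ≤ω-preorder

0≤ω : ∀ {x} → fin 0 ≤ω x
0≤ω {fin n} = fin≤fin z≤n
0≤ω {ω}     = ≤ω-top _

ω≤⇒≡ω : ∀ {x} → ω ≤ω x → x ≡ ω
ω≤⇒≡ω (≤ω-top ω) = refl

ω≰fin : ∀ {n} → ¬ ω ≤ω fin n
ω≰fin ()

0<ω1+n : ∀ {n} → fin 0 <ω fin (suc n)
0<ω1+n = 0≤ω , λ ()

fin<ωω : ∀ {n} → fin n <ω ω
fin<ωω = ≤ω-top _ , λ ()

1+n≤x⇒x≰n : ∀ {x n} → fin (suc n) ≤ω x → ¬ x ≤ω fin n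
1+n≤x⇒x≰n (fin≤fin 1+n≤m) (fin≤fin m≤n) = n≮n _ (≤-trans 1+n≤m m≤n)

1+n≰x⇒x≤n : ∀ {x n} → ¬ fin (suc n) ≤ω x → x ≤ω fin n
1+n≰x⇒x≤n {fin m} {n} 1+n≰m with m ≤? n
... | yes m≤n = fin≤fin m≤n
... | no  m≰n = ⊥-elim (1+n≰m (fin≤fin (≰⇒> m≰n)))
1+n≰x⇒x≤n {ω} 1+n≰ω = ⊥-elim (1+n≰ω (≤ω-top _))

<ω1+n⇒≤n : ∀ {x n} → x <ω fin (suc n) → x ≤ω fin n
<ω1+n⇒≤n (x≤1+n , x≢1+n) = 1+n≰x⇒x≤n (x≢1+n ∘ ≤ω-antisym x≤1+n)

≤ω-from-fin : ∀ {x z} → (∀ n → fin n ≤ω x → fin n ≤ω z) → x ≤ω z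
≤ω-from-fin {fin n} below = below n ≤ω-refl
≤ω-from-fin {ω} {fin m} below = ⊥-elim (1+n≤x⇒x≰n (below (suc m) (≤ω-top _)) ≤ω-refl)
≤ω-from-fin {ω} {ω}     _     = ≤ω-top ω

IsLast-ω⇒fn-fin≢ω : ∀ f {n} → IsLast f ω → fn f (fin n) ≢ ω
IsLast-ω⇒fn-fin≢ω f {n} (_ , least) fn≡ω = ω≰fin (least (fin n) (trans fn≡ω (sym fω≡ω)))
  where
  fω≡ω : fn f ω ≡ ω
  fω≡ω = ω≤⇒≡ω (subst (_≤ω fn f ω) fn≡ω (supUB f n))

IsLast-ω⇒fn-ω≡ω : ∀ f → IsLast f ω → fn f ω ≡ ω
IsLast-ω⇒fn-ω≡ω f (_ , least) with fn f ω in fω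
... | ω           = refl
... | fin zero    = ⊥-elim (ω≰fin (least (fin 0) (strict f)))
... | fin (suc n) = ⊥-elim (1+n≤x⇒x≰n (≤ω-reflexive (sym fω)) (supLUB f (fin n) below))
  where
  below : ∀ k → fn f (fin k) ≤ω fin n
  below k = 1+n≰x⇒x≤n λ 1+n≤fk →
    ω≰fin (least (fin k) (≤ω-antisym (≤ω-trans (supUB f k) (≤ω-reflexive fω)) 1+n≤fk))

identity-IsLast-ω : ∀ {f} → (∀ x → fn f x ≡ x) → IsLast f ω
identity-IsLast-ω {f} f≗id = refl , λ k fk≡fω →
  ≤ω-reflexive (trans (sym (f≗id ω)) (trans (sym fk≡fω) (f≗id k)))

∘-IsLast-ω : ∀ {f g c} → (∀ x → fn c x ≡ fn f (fn g x)) →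
             IsLast f ω → IsLast g ω → IsLast c ω
∘-IsLast-ω {f} {g} {c} c≗f∘g last-f last-g = refl , λ k ck≡cω →
  proj₂ last-g k (trans (ω≤⇒≡ω (proj₂ last-f (fn g k) (fgk≡fω k ck≡cω))) (sym gω≡ω))
  where
  gω≡ω : fn g ω ≡ ω
  gω≡ω = IsLast-ω⇒fn-ω≡ω g last-g

  fgk≡fω : ∀ k → fn c k ≡ fn c ω → fn f (fn g k) ≡ fn f ω
  fgk≡fω k ck≡cω = begin-equality
    fn f (fn g k)  ≡⟨ c≗f∘g k ⟨
    fn c k         ≡⟨ ck≡cω ⟩
    fn c ω         ≡⟨ c≗f∘g ω ⟩
    fn f (fn g ω)  ≡⟨ cong (fn f) gω≡ω ⟩
    fn f ω         ∎

step : ℕ → ω⁺ → ℕ → ω⁺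
step n       y zero    = fin 0
step zero    y (suc k) = y
step (suc n) y (suc k) = step n y k

step-mono : ∀ n y {k l} → k ≤ l → step n y k ≤ω step n y l
step-mono n       y {zero}          _         = 0≤ω
step-mono zero    y {suc k} {suc l} _         = ≤ω-refl
step-mono (suc n) y {suc k} {suc l} (s≤s k≤l) = step-mono n y k≤l

step-≤ : ∀ n y k → step n y k ≤ω y
step-≤ n       y zero    = 0≤ω
step-≤ zero    y (suc k) = ≤ω-refl
step-≤ (suc n) y (suc k) = step-≤ n y k

step-1+n : ∀ n y → step n y (suc n) ≡ y
step-1+n zero    y = refl
step-1+n (suc n) y = step-1+n n y

step-cases : ∀ n y k → step n y k ≡ fin 0 ⊎ (step n y k ≡ y × (suc n ≤ k))
step-cases n       y zero    = inj₁ refl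
step-cases zero    y (suc k) = inj₂ (refl , s≤s z≤n)
step-cases (suc n) y (suc k) with step-cases n y k
... | inj₁ ≡0           = inj₁ ≡0
... | inj₂ (≡y , 1+n≤k) = inj₂ (≡y , s≤s 1+n≤k)

stepWarp : ℕ → ω⁺ → TimeWarp
stepWarp n y = record
  { fn     = fn′
  ; mono   = mono′
  ; strict = refl
  ; supUB  = step-≤ n y
  ; supLUB = λ u below → subst (_≤ω u) (step-1+n n y) (below (suc n))
  }
  where
  fn′ : ω⁺ → ω⁺
  fn′ (fin k) = step n y k
  fn′ ω       = y

  mono′ : ∀ {x z} → x ≤ω z → fn′ x ≤ω fn′ z
  mono′ (fin≤fin k≤l)      = step-mono n y k≤l
  mono′ {fin k} (≤ω-top _) = step-≤ n y k
  mono′ {ω}     (≤ω-top _) = ≤ω-refl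

module Residual {f g : TimeWarp} (residual : IsResidual f g) where

  f∘g≤p : ∀ x → fn f (fn g x) ≤ω p x
  f∘g≤p = proj₁ residual

  residual-lower : ∀ {n y} → fn f y ≤ω fin n → y ≤ω fn g (fin (suc n))
  residual-lower {n} {y} fy≤n =
    subst (_≤ω fn g (fin (suc n))) (step-1+n n y)
          (proj₂ residual (stepWarp n y) f∘step≤p (fin (suc n)))
    where
    f∘step≤p : ∀ x → fn f (fn (stepWarp n y) x) ≤ω p x
    f∘step≤p ω = ≤ω-top _
    f∘step≤p (fin k) with step-cases n y k
    ... | inj₁ ≡0 = begin
      fn f (step n y k)  ≡⟨ cong (fn f) ≡0 ⟩
      fn f (fin 0)       ≡⟨ strict f ⟩
      fin 0              ≲⟨ 0≤ω ⟩
      fin (k ∸ 1)        ∎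
    ... | inj₂ (≡y , s≤s n≤k∸1) = begin
      fn f (step n y k)  ≡⟨ cong (fn f) ≡y ⟩
      fn f y             ≲⟨ fy≤n ⟩
      fin n              ≲⟨ fin≤fin n≤k∸1 ⟩
      fin (k ∸ 1)        ∎

  residual-ω-lower : ∀ {m} → fn f (fin m) ≢ ω → fin m ≤ω fn g ω
  residual-ω-lower {m} fm≢ω with fn f (fin m) in fm
  ... | ω     = ⊥-elim (fm≢ω refl)
  ... | fin k = ≤ω-trans (residual-lower (≤ω-reflexive fm)) (supUB g (suc k))

  residual-fin-upper : ∀ {m} n → fin n ≤ω fn f (fin (suc m)) → fn g (fin n) ≤ω fin m
  residual-fin-upper zero    _ = ≤ω-trans (≤ω-reflexive (strict g)) 0≤ω
  residual-fin-upper {m} (suc n) 1+n≤f[1+m] = 1+n≰x⇒x≤n λ 1+m≤gx →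
    1+n≤x⇒x≰n 1+n≤f[1+m] (≤ω-trans (mono f 1+m≤gx) (f∘g≤p (fin (suc n))))

  residual-upper : ∀ {x m} → x ≤ω fn f (fin (suc m)) → fn g x ≤ω fin m
  residual-upper {fin n} = residual-fin-upper n
  residual-upper {ω}     ω≤f[1+m] =
    supLUB g _ λ n → residual-fin-upper n (≤ω-trans (≤ω-top _) ω≤f[1+m])

  residual-IsLast-ω : fn f (fn g ω) ≡ ω → IsLast g ω
  residual-IsLast-ω fgω≡ω = refl , λ where
    ω       _         → ≤ω-top ω
    (fin n) gn≡gω → ⊥-elim (ω≰fin (subst (_≤ω fin (n ∸ 1))
                                         (trans (cong (fn f) gn≡gω) fgω≡ω)
                                         (f∘g≤p (fin n))))

module _ {Δ : SampleSet} (saturated : Saturated Δ) {δ : Sample → ω⁺}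
         (diagram : IsDiagram Δ δ) (H : Hom) where
  open IsDiagram diagram

  ⟦_⟧ : BTerm → TimeWarp
  ⟦ t ⟧ = h H ⌜ t ⌝

  lastₛ-∈ : ∀ {t α} → t [ α ] ∈ Δ → lastₛ t ∈ Δ
  lastₛ-∈ {t} {α} t[α]∈Δ = saturated (saturated t[α]∈Δ (r5 t α)) (r1 t _)

  𝟏-stronglyExtends : StronglyExtends Δ δ 𝟏 ⟦ 𝟏 ⟧
  𝟏-stronglyExtends =
    (λ α 𝟏[α]∈Δ → trans (h-𝟏 H (δ α)) (sym (d6 α 𝟏[α]∈Δ))) ,
    (λ _ _ → identity-IsLast-ω {⟦ 𝟏 ⟧} (h-𝟏 H))

  ·-stronglyExtends : ∀ {t u} → StronglyExtends Δ δ t ⟦ t ⟧ → StronglyExtends Δ δ u ⟦ u ⟧ →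
                      StronglyExtends Δ δ (t · u) ⟦ t · u ⟧
  ·-stronglyExtends {t} {u} (ext-t , last-t) (ext-u , last-u) = ext , last
    where
    ext : Extends Δ δ (t · u) ⟦ t · u ⟧
    ext α t·u[α]∈Δ = begin-equality
      fn ⟦ t · u ⟧ (δ α)         ≡⟨ h-· H ⌜ t ⌝ ⌜ u ⌝ (δ α) ⟩
      fn ⟦ t ⟧ (fn ⟦ u ⟧ (δ α))  ≡⟨ cong (fn ⟦ t ⟧) (ext-u α (saturated t[u[α]]∈Δ (r1 t _))) ⟩
      fn ⟦ t ⟧ (δ (u [ α ]))     ≡⟨ ext-t _ t[u[α]]∈Δ ⟩
      δ (t [ u [ α ] ])          ≡⟨ d8 t u α t·u[α]∈Δ ⟨
      δ ((t · u) [ α ])          ∎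
      where
      t[u[α]]∈Δ = saturated t·u[α]∈Δ (r2 t u α)

    last : DiagNonEmpty Δ (t · u) → δ (lastₛ (t · u)) ≡ ω → IsLast ⟦ t · u ⟧ ω
    last (α , t·u[α]∈Δ) last-t·u≡ω =
      ∘-IsLast-ω {⟦ t ⟧} {⟦ u ⟧} {⟦ t · u ⟧} (h-· H ⌜ t ⌝ ⌜ u ⌝) (last-t (_ , t[u[α]]∈Δ) (proj₁ lasts≡ω))
                                                                 (last-u (_ , u[α]∈Δ) (proj₂ lasts≡ω))
      where
      t[u[α]]∈Δ = saturated t·u[α]∈Δ (r2 t u α)
      u[α]∈Δ    = saturated t[u[α]]∈Δ (r1 t _)
      lasts≡ω   = d9 t u (lastₛ-∈ t·u[α]∈Δ) (lastₛ-∈ t[u[α]]∈Δ) (lastₛ-∈ u[α]∈Δ) last-t·u≡ω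

  module _ {t : BTerm} (strong-t : StronglyExtends Δ δ t ⟦ t ⟧) where
    open Residual {⟦ t ⟧} {⟦ t ′ ⟧} (h-′ H ⌜ t ⌝)

    private
      f g : TimeWarp
      f = ⟦ t ⟧
      g = ⟦ t ′ ⟧

      ext-t : ∀ {α} → t [ α ] ∈ Δ → fn f (δ α) ≡ δ (t [ α ])
      ext-t = proj₁ strong-t _

    last′≡ω⇒IsLast-ω : ∀ {α} → (t ′) [ α ] ∈ Δ → δ (lastₛ (t ′)) ≡ ω → IsLast f ω
    last′≡ω⇒IsLast-ω {α} t′[α]∈Δ last′≡ω =
      proj₂ strong-t (_ , t[t′[α]]∈Δ) (d12 t (lastₛ-∈ t′[α]∈Δ) (lastₛ-∈ t[t′[α]]∈Δ) last′≡ω)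
      where
      t[t′[α]]∈Δ = saturated t′[α]∈Δ (r4 t α)

    diagram-below-p : ∀ {β} → (t ′) [ β ] ∈ Δ → fn f (δ ((t ′) [ β ])) ≤ω p (δ β)
    diagram-below-p {β} t′[β]∈Δ with δ β in β≡
    ... | ω           = ≤ω-top _
    ... | fin zero    = ≤ω-reflexive (trans (cong (fn f) (d2 (t ′) β t′[β]∈Δ β≡)) (strict f))
    ... | fin (suc n) = <ω1+n⇒≤n (subst (fn f (δ ((t ′) [ β ])) <ω_) β≡ f[t′β]<β)
      where
      f[t′β]<β : fn f (δ ((t ′) [ β ])) <ω δ β
      f[t′β]<β = subst (_<ω δ β) (sym (ext-t (saturated t′[β]∈Δ (r4 t β))))
                   (d10 t β t′[β]∈Δ (subst (fin 0 <ω_) (sym β≡) 0<ω1+n)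
                                    (subst (_<ω ω) (sym β≡) fin<ωω))

    diagram-suc : ∀ {α m} → (t ′) [ α ] ∈ Δ → δ ((t ′) [ α ]) ≡ fin m →
                  δ α ≤ω fn f (fin (suc m))
    diagram-suc {α} {m} t′[α]∈Δ t′[α]≡m = begin
      δ α                                   ≲⟨ d11 t α t′[α]∈Δ (subst (_<ω ω) (sym t′[α]≡m) fin<ωω) ⟩
      δ (t [ sucₛ ((t ′) [ α ]) ])          ≡⟨ ext-t t[suc]∈Δ ⟨
      fn f (δ (sucₛ ((t ′) [ α ])))         ≡⟨ cong (fn f) (d3 _ (saturated t[suc]∈Δ (r1 t _))) ⟩
      fn f (S (δ ((t ′) [ α ])))            ≡⟨ cong (fn f ∘ S) t′[α]≡m ⟩
      fn f (fin (suc m))                    ∎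
      where
      t[suc]∈Δ = saturated t′[α]∈Δ (r6 t α)

    fn-below-ω-sample≢ω : ∀ {α n} → (t ′) [ α ] ∈ Δ → δ α ≡ ω →
                          fin n ≤ω δ ((t ′) [ α ]) → fn f (fin n) ≢ ω
    fn-below-ω-sample≢ω {α} {n} t′[α]∈Δ α≡ω n≤t′[α] with δ (lastₛ (t ′)) in last′≡
    ... | ω     = IsLast-ω⇒fn-fin≢ω f (last′≡ω⇒IsLast-ω t′[α]∈Δ last′≡)
    ... | fin l = λ fn≡ω → ω≰fin (begin
      ω                                     ≡⟨ fn≡ω ⟨
      fn f (fin n)                          ≲⟨ mono f n≤t′[α] ⟩
      fn f (δ ((t ′) [ α ]))                ≡⟨ cong (fn f) t′[α]≡t′[last] ⟨
      fn f (δ ((t ′) [ lastₛ (t ′) ]))      ≲⟨ diagram-below-p t′[last]∈Δ ⟩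
      p (δ (lastₛ (t ′)))                   ≡⟨ cong p last′≡ ⟩
      fin (l ∸ 1)                           ∎)
      where
      t′[last]∈Δ = saturated t′[α]∈Δ (r5 (t ′) α)
      t′[α]≡t′[last] : δ ((t ′) [ lastₛ (t ′) ]) ≡ δ ((t ′) [ α ])
      t′[α]≡t′[last] = Equivalence.to (d4 (t ′) α t′[α]∈Δ)
                         (subst (δ (lastₛ (t ′)) ≤ω_) (sym α≡ω) (≤ω-top _))

    ′-extends : Extends Δ δ (t ′) g
    ′-extends α t′[α]∈Δ = ≤ω-antisym upper lower
      where
      upper : fn g (δ α) ≤ω δ ((t ′) [ α ])
      upper with δ ((t ′) [ α ]) in t′[α]≡
      ... | ω     = ≤ω-top _
      ... | fin m = residual-upper (diagram-suc t′[α]∈Δ t′[α]≡)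

      lower : δ ((t ′) [ α ]) ≤ω fn g (δ α)
      lower with δ α in α≡
      ... | fin zero    = ≤ω-reflexive (trans (d2 (t ′) α t′[α]∈Δ α≡) (sym (strict g)))
      ... | fin (suc n) = residual-lower (subst (λ x → fn f (δ ((t ′) [ α ])) ≤ω p x) α≡
                                                (diagram-below-p t′[α]∈Δ))
      ... | ω           = ≤ω-from-fin λ n n≤t′[α] →
        residual-ω-lower (fn-below-ω-sample≢ω t′[α]∈Δ α≡ n≤t′[α])

    ′-stronglyExtends : StronglyExtends Δ δ (t ′) g
    ′-stronglyExtends = ′-extends , last
      where
      last : DiagNonEmpty Δ (t ′) → δ (lastₛ (t ′)) ≡ ω → IsLast g ω
      last (α , t′[α]∈Δ) last′≡ω = residual-IsLast-ω (begin-equality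
        fn f (fn g ω)                       ≡⟨ cong (fn f ∘ fn g) last′≡ω ⟨
        fn f (fn g (δ (lastₛ (t ′))))       ≡⟨ cong (fn f) (′-extends _ t′[last]∈Δ) ⟩
        fn f (δ ((t ′) [ lastₛ (t ′) ]))    ≡⟨ cong (fn f) (d5 (t ′) t′[last]∈Δ last′≡ω) ⟩
        fn f ω                              ≡⟨ IsLast-ω⇒fn-ω≡ω f (last′≡ω⇒IsLast-ω t′[α]∈Δ last′≡ω) ⟩
        ω                                   ∎)
        where
        t′[last]∈Δ = saturated t′[α]∈Δ (r5 (t ′) α)

lemma3p8 : (Δ : SampleSet) → Saturated Δ → (δ : Sample → ω⁺) → IsDiagram Δ δ →
           (t : BTerm) → (H : Hom) →
           (∀ x → Occurs x t → StronglyExtends Δ δ (bvar x) (h H (var x))) →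
           StronglyExtends Δ δ t (h H ⌜ t ⌝)
lemma3p8 Δ sat δ D (bvar x) H vars = vars x here
lemma3p8 Δ sat δ D 𝟏       H _    = 𝟏-stronglyExtends sat D H
lemma3p8 Δ sat δ D (t · u) H vars =
  ·-stronglyExtends sat D H (lemma3p8 Δ sat δ D t H (λ x → vars x ∘ ·ˡ))
                            (lemma3p8 Δ sat δ D u H (λ x → vars x ∘ ·ʳ))
lemma3p8 Δ sat δ D (t ′)   H vars =
  ′-stronglyExtends sat D H (lemma3p8 Δ sat δ D t H (λ x → vars x ∘ ′-in))
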